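{- For all formulas $X,Y\in$ FI: (a) $+X\equiv X$ is a theorem of LD; (b) $(X\bullet Y)\equiv(X\wedge Y)$ is a theorem of LD.
   Context: Logic LD. Atoms: classical atoms $a,b,\dots$ and alternate atoms $\underline a,\underline b,\dots$. Formulas: least set containing the atoms and closed under $\sim X$, $\neg X$, $X\supset Y$, $X\bullet Y$, $X\cup Y$, $X\equiv Y$. Abbreviations: $+X:=\neg\sim X$, $X\vee Y:=+(X\cup Y)$, $X\wedge Y:=+(X\bullet Y)$, $X\rightarrow Y:=+(X\supset Y)$, $X\leftrightarrow Y:=+(X\equiv Y)$. Alternate formulas $\underline X$: alternate atoms or formulas $\neg Y$. FI: formulas built from alternate atoms with $\neg,\wedge,\vee,\rightarrow,\leftrightarrow$. Axiom schemes: Ax1.1 $X\supset(Y\supset X)$; Ax1.2 $(X\supset(Y\supset Z))\supset((X\supset Y)\supset(X\supset Z))$; Ax1.3 $X\supset(X\cup Y)$; Ax1.4 $Y\supset(X\cup Y)$; Ax1.5 $(X\supset Z)\supset((Y\supset Z)\supset((X\cup Y)\supset Z))$; Ax1.6 $(X\bullet Y)\supset X$; Ax1.7 $(X\bullet Y)\supset Y$; Ax1.8 $(X\supset Y)\supset((X\supset Z)\supset(X\supset(Y\bullet Z)))$; Ax1.9 $X\supset(\sim X\supset Y)$; Ax1.10 $X\cup\sim X$; Ax1.11 $(X\equiv Y)\supset(X\supset Y)$; Ax1.12 $(X\equiv Y)\supset(Y\supset X)$; Ax1.13 $(X\supset Y)\supset((Y\supset X)\supset(X\equiv Y))$; Ax2.1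 $(X\supset Y)\supset(+X\supset+Y)$; Ax2.2 $\neg X\supset\sim X$; Ax2.3 $\underline X\supset+\underline X$; Ax2.4 $+A$ for every instance $A$ of Ax1.1–Ax2.3. Rule: modus ponens. Theorems: formulas derivable from the axioms. -}

module Defs where

open import Data.Nat using (ℕ)
open import Data.Product using (_×_)

infixr 5 _⊃_
infixr 6 _∪_
infixr 7 _•_
infix 4 _≣_

data Formula : Set where
  catom : ℕ → Formula          -- classical atoms a, b, …
  aatom : ℕ → Formula          -- alternate atoms a̲, b̲, …
  ∼_    : Formula → Formula
  ¬′_   : Formula → Formula
  _⊃_   : Formula → Formula → Formula
  _•_   : Formula → Formula → Formula
  _∪_   : Formula → Formula → Formula
  _≣_   : Formula → Formula → Formula

+_ : Formula → Formula
+ X = ¬′ (∼ X)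

_∨′_ : Formula → Formula → Formula
X ∨′ Y = + (X ∪ Y)

_∧′_ : Formula → Formula → Formula
X ∧′ Y = + (X • Y)

_⇒′_ : Formula → Formula → Formula
X ⇒′ Y = + (X ⊃ Y)

_⇔′_ : Formula → Formula → Formula
X ⇔′ Y = + (X ≣ Y)

data Alternate : Formula → Set where
  alt-atom : ∀ n → Alternate (aatom n)
  alt-neg  : ∀ Y → Alternate (¬′ Y)

data BaseAxiom : Formula → Set where
  ax1-1  : ∀ X Y → BaseAxiom (X ⊃ (Y ⊃ X))
  ax1-2  : ∀ X Y Z → BaseAxiom ((X ⊃ (Y ⊃ Z)) ⊃ ((X ⊃ Y) ⊃ (X ⊃ Z)))
  ax1-3  : ∀ X Y → BaseAxiom (X ⊃ (X ∪ Y))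
  ax1-4  : ∀ X Y → BaseAxiom (Y ⊃ (X ∪ Y))
  ax1-5  : ∀ X Y Z → BaseAxiom ((X ⊃ Z) ⊃ ((Y ⊃ Z) ⊃ ((X ∪ Y) ⊃ Z)))
  ax1-6  : ∀ X Y → BaseAxiom ((X • Y) ⊃ X)
  ax1-7  : ∀ X Y → BaseAxiom ((X • Y) ⊃ Y)
  ax1-8  : ∀ X Y Z → BaseAxiom ((X ⊃ Y) ⊃ ((X ⊃ Z) ⊃ (X ⊃ (Y • Z))))
  ax1-9  : ∀ X Y → BaseAxiom (X ⊃ ((∼ X) ⊃ Y))
  ax1-10 : ∀ X → BaseAxiom (X ∪ (∼ X))
  ax1-11 : ∀ X Y → BaseAxiom ((X ≣ Y) ⊃ (X ⊃ Y))
  ax1-12 : ∀ X Y → BaseAxiom ((X ≣ Y) ⊃ (Y ⊃ X))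
  ax1-13 : ∀ X Y → BaseAxiom ((X ⊃ Y) ⊃ ((Y ⊃ X) ⊃ (X ≣ Y)))
  ax2-1  : ∀ X Y → BaseAxiom ((X ⊃ Y) ⊃ ((+ X) ⊃ (+ Y)))
  ax2-2  : ∀ X → BaseAxiom ((¬′ X) ⊃ (∼ X))
  ax2-3  : ∀ X → Alternate X → BaseAxiom (X ⊃ (+ X))

data Axiom : Formula → Set where
  base : ∀ {A} → BaseAxiom A → Axiom A
  ax2-4 : ∀ {A} → BaseAxiom A → Axiom (+ A)

data ⊢_ : Formula → Set where
  axiom : ∀ {A} → Axiom A → ⊢ A
  mp    : ∀ {A B} → ⊢ A → ⊢ (A ⊃ B) → ⊢ B

data FI : Formula → Set where
  fi-atom : ∀ n → FI (aatom n)
  fi-neg  : ∀ {X} → FI X → FI (¬′ X)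
  fi-and  : ∀ {X Y} → FI X → FI Y → FI (X ∧′ Y)
  fi-or   : ∀ {X Y} → FI X → FI Y → FI (X ∨′ Y)
  fi-imp  : ∀ {X Y} → FI X → FI Y → FI (X ⇒′ Y)
  fi-iff  : ∀ {X Y} → FI X → FI Y → FI (X ⇔′ Y)

-- Every FI formula is alternate (an alternate atom or a negation), and for alternate X
-- Ax2.3 gives X ⊃ +X while +X ⊃ X holds for every X, since +X = ¬∼X implies ∼∼X by Ax2.2
-- and ∼∼X implies X by excluded middle (Ax1.10) and explosion (Ax1.9). For a conjunction
-- only the alternate right conjunct matters: +Y transfers to +(X • Y) through Ax2.1.
module Submission where

open import Defs
open import Data.Product using (_×_; _,_)

⊢-base : ∀ {A} → BaseAxiom A → ⊢ A
⊢-base b = axiom (base b)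

⊃-const : ∀ {A B} → ⊢ B → ⊢ (A ⊃ B)
⊃-const {A} {B} ⊢B = mp ⊢B (⊢-base (ax1-1 B A))

⊃-distrib : ∀ {A B C} → ⊢ (A ⊃ (B ⊃ C)) → ⊢ (A ⊃ B) → ⊢ (A ⊃ C)
⊃-distrib {A} {B} {C} ⊢A⊃B⊃C ⊢A⊃B = mp ⊢A⊃B (mp ⊢A⊃B⊃C (⊢-base (ax1-2 A B C)))

⊃-trans : ∀ {A B C} → ⊢ (A ⊃ B) → ⊢ (B ⊃ C) → ⊢ (A ⊃ C)
⊃-trans ⊢A⊃B ⊢B⊃C = ⊃-distrib (⊃-const ⊢B⊃C) ⊢A⊃B

≣-intro : ∀ {A B} → ⊢ (A ⊃ B) → ⊢ (B ⊃ A) → ⊢ (A ≣ B)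
≣-intro {A} {B} ⊢A⊃B ⊢B⊃A = mp ⊢B⊃A (mp ⊢A⊃B (⊢-base (ax1-13 A B)))

∼∼-elim : ∀ X → ⊢ (∼ ∼ X ⊃ X)
∼∼-elim X = mp (⊢-base (ax1-10 X)) (mp (⊢-base (ax1-9 (∼ X) X)) (mp (⊢-base (ax1-1 X (∼ ∼ X)))
              (⊢-base (ax1-5 X (∼ X) (∼ ∼ X ⊃ X)))))

+-elim : ∀ X → ⊢ (+ X ⊃ X)
+-elim X = ⊃-trans (⊢-base (ax2-2 (∼ X))) (∼∼-elim X)

+-intro : ∀ {X} → Alternate X → ⊢ (X ⊃ + X)
+-intro {X} altX = ⊢-base (ax2-3 X altX)

+-≣-alternate : ∀ {X} → Alternate X → ⊢ (+ X ≣ X)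
+-≣-alternate {X} altX = ≣-intro (+-elim X) (+-intro altX)

•-⊃-+•-alternateʳ : ∀ X {Y} → Alternate Y → ⊢ ((X • Y) ⊃ + (X • Y))
•-⊃-+•-alternateʳ X {Y} altY = ⊃-distrib ⊢•⊃+Y⊃+• ⊢•⊃+Y
  where
  ⊢•⊃+Y : ⊢ ((X • Y) ⊃ + Y)
  ⊢•⊃+Y = ⊃-trans (⊢-base (ax1-7 X Y)) (+-intro altY)

  ⊢•⊃+Y⊃+• : ⊢ ((X • Y) ⊃ (+ Y ⊃ + (X • Y)))
  ⊢•⊃+Y⊃+• = ⊃-trans (⊢-base (ax1-1 (X • Y) Y)) (⊢-base (ax2-1 Y (X • Y)))

•-≣-∧-alternateʳ : ∀ X {Y} → Alternate Y → ⊢ ((X • Y) ≣ (X ∧′ Y))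
•-≣-∧-alternateʳ X altY = ≣-intro (•-⊃-+•-alternateʳ X altY) (+-elim (X • _))

FI⇒Alternate : ∀ {X} → FI X → Alternate X
FI⇒Alternate (fi-atom n) = alt-atom n
FI⇒Alternate (fi-neg {X} _) = alt-neg X
FI⇒Alternate (fi-and _ _) = alt-neg _
FI⇒Alternate (fi-or _ _) = alt-neg _
FI⇒Alternate (fi-imp _ _) = alt-neg _
FI⇒Alternate (fi-iff _ _) = alt-neg _

mainTheorem13 : ∀ X Y → FI X → FI Y → (⊢ ((+ X) ≣ X)) × (⊢ ((X • Y) ≣ (X ∧′ Y)))
mainTheorem13 X Y fiX fiY =
  +-≣-alternate (FI⇒Alternate fiX) , •-≣-∧-alternateʳ X (FI⇒Alternate fiY)
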